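{- For any integer $k\geqslant 2$, there exist positive integers $m$ and $n$ such that the system of simultaneous congruences \[ X\equiv 2^{2m-1}-1\pmod{2^{2m}},\qquad 3^{k-1}X\equiv 2^{2n}-1\pmod{2^{2n+1}} \] has an integer solution $X$. -}

module Defs where

open import Data.Integer using (ℤ; _-_)
open import Data.Integer.Divisibility using (_∣_)

_≡_[mod_] : ℤ → ℤ → ℤ → Set
a ≡ b [mod m ] = m ∣ (a - b)

{-# OPTIONS --safe #-}
module Submission where

-- The congruences say that X + 1 has exact 2-adic valuation 2m − 1 and that
-- aX + 1, for a = 3^(k−1), has exact 2-adic valuation 2n.  If k − 1 is odd then
-- a ≡ 3 (mod 8) and X = 1 works.  If k − 1 is even then a = 1 + 8c with
-- c = 2^s w, w odd, and aX + 1 = a(X + 1) − 2^(s+3) w.  For odd s take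
-- X + 1 = 2^(s+4), so that aX + 1 = 2^(s+3)(2a − w); for even s take
-- X + 1 = 2^(s+3)(w + 2), so that aX + 1 = 2^(s+4)(1 + 2^(s+2) w (w + 2)).

open import Defs
open import Data.Nat using (ℕ; zero; suc; _≤_; _<_; _∸_; s≤s; z≤n) renaming (_*_ to _*ℕ_; _+_ to _+ℕ_)
open import Data.Integer using (ℤ; +_; _+_; _-_; -_; _*_; _^_)
open import Data.Integer.Divisibility using (_∣_)
open import Data.Integer.Divisibility.Signed using (divides; ∣⇒∣ᵤ)
open import Data.Integer.Tactic.RingSolver using (solve-∀)
open import Data.Product using (Σ; ∃; ∃₂; _×_; _,_)
open import Data.Sum using (_⊎_; inj₁; inj₂)
open import Induction.WellFounded using (Acc; acc)
open import Relation.Binary.PropositionalEquality using (_≡_; refl; sym; trans; cong; subst; subst₂; module ≡-Reasoning)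
import Data.Nat.Induction as ℕ
import Data.Nat.Properties as ℕ
import Data.Integer.Properties as ℤ

even⊎odd : ∀ n → (∃ λ q → n ≡ 2 *ℕ q) ⊎ (∃ λ q → n ≡ suc (2 *ℕ q))
even⊎odd zero = inj₁ (0 , refl)
even⊎odd (suc n) with even⊎odd n
... | inj₁ (q , n≡2q)   = inj₂ (q , cong suc n≡2q)
... | inj₂ (q , n≡1+2q) = inj₁ (suc q , trans (cong suc n≡1+2q) (sym (ℕ.*-suc 2 q)))

+[1+n]≡4^i*odd⊎2*4^i*odd : ∀ n → ∃₂ λ i V →
  let y = (+ 4) ^ i * (+ 1 + + 2 * V) in (+ suc n ≡ y) ⊎ (+ suc n ≡ + 2 * y)
+[1+n]≡4^i*odd⊎2*4^i*odd n = go n (ℕ.<-wellFounded (suc n))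
  where
  go : ∀ n → Acc _<_ (suc n) → ∃₂ λ i V →
    let y = (+ 4) ^ i * (+ 1 + + 2 * V) in (+ suc n ≡ y) ⊎ (+ suc n ≡ + 2 * y)
  go n (acc rec) with even⊎odd (suc n)
  ... | inj₂ (v , 1+n≡1+2v) = 0 , + v , inj₁ (begin
    + suc n              ≡⟨ cong +_ 1+n≡1+2v ⟩
    + 1 + + (2 *ℕ v)     ≡⟨ cong (λ t → + 1 + t) (ℤ.pos-* 2 v) ⟩
    + 1 + + 2 * + v      ≡⟨ ℤ.*-identityˡ _ ⟨
    + 1 * (+ 1 + + 2 * + v) ∎)
    where open ≡-Reasoning
  ... | inj₁ (zero , ())
  ... | inj₁ (suc q , 1+n≡2[1+q])
    with go q (rec (subst (suc q <_) (sym 1+n≡2[1+q]) (ℕ.m<m+n (suc q) (s≤s z≤n))))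
  ...   | i , V , inj₁ 1+q≡y = i , V , inj₂ (trans (cong +_ 1+n≡2[1+q]) (cong (+ 2 *_) 1+q≡y))
  ...   | i , V , inj₂ 1+q≡2y = suc i , V , inj₁
    (trans (cong +_ 1+n≡2[1+q]) (trans (cong (+ 2 *_) 1+q≡2y) (2*[2*[Q*W]] ((+ 4) ^ i) (+ 1 + + 2 * V))))
    where
    2*[2*[Q*W]] : ∀ (Q W : ℤ) → + 2 * (+ 2 * (Q * W)) ≡ + 4 * Q * W
    2*[2*[Q*W]] = solve-∀

multiple⇒∣ : ∀ {k i : ℤ} q → i ≡ q * k → k ∣ i
multiple⇒∣ q eq = ∣⇒∣ᵤ (divides q eq)

2^[2*n]≡4^n : ∀ n → (+ 2) ^ (2 *ℕ n) ≡ (+ 4) ^ n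
2^[2*n]≡4^n n = sym (ℤ.^-*-assoc (+ 2) 2 n)

3^[2*q]≡9^q : ∀ q → (+ 3) ^ (2 *ℕ q) ≡ (+ 9) ^ q
3^[2*q]≡9^q q = sym (ℤ.^-*-assoc (+ 3) 2 q)

9^q≡1+8*c : ∀ q → ∃ λ c → (+ 9) ^ q ≡ + 1 + + 8 * + c
9^[1+q]≡1+8*[1+c] : ∀ q → ∃ λ c → (+ 9) ^ suc q ≡ + 1 + + 8 * + suc c

9^q≡1+8*c zero = 0 , refl
9^q≡1+8*c (suc q) with 9^[1+q]≡1+8*[1+c] q
... | c , eq = suc c , eq

9^[1+q]≡1+8*[1+c] q with 9^q≡1+8*c q
... | c , eq = 9 *ℕ c , (begin
  + 9 * (+ 9) ^ q                     ≡⟨ cong (+ 9 *_) eq ⟩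
  + 9 * (+ 1 + + 8 * + c)             ≡⟨ 9*[1+8*C] (+ c) ⟩
  + 1 + + 8 * (+ 1 + + 9 * + c)       ≡⟨ cong (λ t → + 1 + + 8 * (+ 1 + t)) (sym (ℤ.pos-* 9 c)) ⟩
  + 1 + + 8 * + suc (9 *ℕ c)          ∎)
  where
  open ≡-Reasoning
  9*[1+8*C] : ∀ (C : ℤ) → + 9 * (+ 1 + + 8 * C) ≡ + 1 + + 8 * (+ 1 + + 9 * C)
  9*[1+8*C] = solve-∀

SystemSolvable : ℤ → Set
SystemSolvable a = Σ ℕ λ m → Σ ℕ λ n → 1 ≤ m × 1 ≤ n ×
    Σ ℤ λ X →
    (X ≡ ((+ 2) ^ (2 *ℕ m ∸ 1) - + 1) [mod ((+ 2) ^ (2 *ℕ m)) ])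
    × ((a * X) ≡ ((+ 2) ^ (2 *ℕ n) - + 1) [mod ((+ 2) ^ (2 *ℕ n +ℕ 1)) ])

systemSolvable-intro : ∀ a (i j : ℕ) (X q r : ℤ) →
  X - (+ 2 * (+ 4) ^ i - + 1) ≡ q * (+ 4) ^ suc i →
  a * X - ((+ 4) ^ suc j - + 1) ≡ r * (+ 2 * (+ 4) ^ suc j) →
  SystemSolvable a
systemSolvable-intro a i j X q r X≡ aX≡ =
  suc i , suc j , s≤s z≤n , s≤s z≤n , X ,
  subst₂ (λ p m → X ≡ p - + 1 [mod m ]) (sym 2^[2m-1]) (sym (2^[2*n]≡4^n (suc i))) (multiple⇒∣ q X≡) ,
  subst₂ (λ p m → (a * X) ≡ p - + 1 [mod m ]) (sym (2^[2*n]≡4^n (suc j))) (sym 2^[2n+1]) (multiple⇒∣ r aX≡)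
  where
  2^[2m-1] : (+ 2) ^ (2 *ℕ suc i ∸ 1) ≡ + 2 * (+ 4) ^ i
  2^[2m-1] = trans (cong (λ e → (+ 2) ^ (e ∸ 1)) (ℕ.*-suc 2 i)) (cong (+ 2 *_) (2^[2*n]≡4^n i))
  2^[2n+1] : (+ 2) ^ (2 *ℕ suc j +ℕ 1) ≡ + 2 * (+ 4) ^ suc j
  2^[2n+1] = trans (cong ((+ 2) ^_) (ℕ.+-comm (2 *ℕ suc j) 1)) (cong (+ 2 *_) (2^[2*n]≡4^n (suc j)))

systemSolvable-3*[1+8*] : ∀ (C : ℤ) → SystemSolvable (+ 3 * (+ 1 + + 8 * C))
systemSolvable-3*[1+8*] C = systemSolvable-intro (+ 3 * (+ 1 + + 8 * C)) 0 0 (+ 1) (+ 0) (+ 3 * C) refl (aX≡ C)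
  where
  aX≡ : ∀ (C : ℤ) → + 3 * (+ 1 + + 8 * C) * + 1 - (+ 4 * + 1 - + 1) ≡ + 3 * C * (+ 2 * (+ 4 * + 1))
  aX≡ = solve-∀

systemSolvable-1+8*4^i*odd : ∀ (i : ℕ) (V : ℤ) →
  SystemSolvable (+ 1 + + 8 * ((+ 4) ^ i * (+ 1 + + 2 * V)))
systemSolvable-1+8*4^i*odd i V =
  systemSolvable-intro (+ 1 + + 8 * (Q * W)) (suc i) (suc i) (+ 8 * Q * W + + 16 * Q - + 1)
    (V + + 1) (+ 2 * Q * W * (W + + 2)) (X≡ Q V) (aX≡ Q V)
  where
  Q = (+ 4) ^ i
  W = + 1 + + 2 * V
  X≡ : ∀ (Q V : ℤ) → + 8 * Q * (+ 1 + + 2 * V) + + 16 * Q - + 1 - (+ 2 * (+ 4 * Q) - + 1)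
               ≡ (V + + 1) * (+ 4 * (+ 4 * Q))
  X≡ = solve-∀
  aX≡ : ∀ (Q V : ℤ) → (+ 1 + + 8 * (Q * (+ 1 + + 2 * V))) * (+ 8 * Q * (+ 1 + + 2 * V) + + 16 * Q - + 1)
                  - (+ 4 * (+ 4 * Q) - + 1)
                ≡ + 2 * Q * (+ 1 + + 2 * V) * ((+ 1 + + 2 * V) + + 2) * (+ 2 * (+ 4 * (+ 4 * Q)))
  aX≡ = solve-∀

systemSolvable-1+8*[2*4^i*odd] : ∀ (i : ℕ) (V : ℤ) →
  SystemSolvable (+ 1 + + 8 * (+ 2 * ((+ 4) ^ i * (+ 1 + + 2 * V))))
systemSolvable-1+8*[2*4^i*odd] i V =
  systemSolvable-intro (+ 1 + + 8 * (+ 2 * (Q * W))) (suc (suc i)) (suc i) (+ 32 * Q - + 1)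
    (+ 0) (- V + + 16 * Q * W) (X≡ Q) (aX≡ Q V)
  where
  Q = (+ 4) ^ i
  W = + 1 + + 2 * V
  X≡ : ∀ (Q : ℤ) → + 32 * Q - + 1 - (+ 2 * (+ 4 * (+ 4 * Q)) - + 1) ≡ + 0 * (+ 4 * (+ 4 * (+ 4 * Q)))
  X≡ = solve-∀
  aX≡ : ∀ (Q V : ℤ) → (+ 1 + + 8 * (+ 2 * (Q * (+ 1 + + 2 * V)))) * (+ 32 * Q - + 1) - (+ 4 * (+ 4 * Q) - + 1)
                ≡ (- V + + 16 * Q * (+ 1 + + 2 * V)) * (+ 2 * (+ 4 * (+ 4 * Q)))
  aX≡ = solve-∀

systemSolvable-1+8*[1+n] : ∀ n → SystemSolvable (+ 1 + + 8 * + suc n)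
systemSolvable-1+8*[1+n] n with +[1+n]≡4^i*odd⊎2*4^i*odd n
... | i , V , inj₁ 1+n≡y  =
  subst (λ c → SystemSolvable (+ 1 + + 8 * c)) (sym 1+n≡y) (systemSolvable-1+8*4^i*odd i V)
... | i , V , inj₂ 1+n≡2y =
  subst (λ c → SystemSolvable (+ 1 + + 8 * c)) (sym 1+n≡2y) (systemSolvable-1+8*[2*4^i*odd] i V)

systemSolvable-3^[1+e] : ∀ e → SystemSolvable ((+ 3) ^ suc e)
systemSolvable-3^[1+e] e with even⊎odd e
... | inj₁ (q , refl) with 9^q≡1+8*c q
...   | c , 9^q≡ =
  subst SystemSolvable (sym (cong (+ 3 *_) (trans (3^[2*q]≡9^q q) 9^q≡))) (systemSolvable-3*[1+8*] (+ c))
systemSolvable-3^[1+e] e | inj₂ (q , refl) with 9^[1+q]≡1+8*[1+c] q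
...   | c , 9^[1+q]≡ =
  subst SystemSolvable (sym 3^[2+2q]≡) (systemSolvable-1+8*[1+n] c)
  where
  3^[2+2q]≡ : (+ 3) ^ suc (suc (2 *ℕ q)) ≡ + 1 + + 8 * + suc c
  3^[2+2q]≡ = trans (cong ((+ 3) ^_) (sym (ℕ.*-suc 2 q))) (trans (3^[2*q]≡9^q (suc q)) 9^[1+q]≡)

lemma2p1 : (k : ℕ) → 2 ≤ k →
    Σ ℕ λ m → Σ ℕ λ n → 1 ≤ m × 1 ≤ n ×
    Σ ℤ λ X →
    (X ≡ ((+ 2) ^ (2 *ℕ m ∸ 1) - + 1) [mod ((+ 2) ^ (2 *ℕ m)) ])
    × (((+ 3) ^ (k ∸ 1) * X) ≡ ((+ 2) ^ (2 *ℕ n) - + 1) [mod ((+ 2) ^ (2 *ℕ n +ℕ 1)) ])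
lemma2p1 (suc (suc k)) _ = systemSolvable-3^[1+e] k
lemma2p1 (suc zero) (s≤s ())
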